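{- Let $\phi\colon F\to G$ be an oddomorphism and let $S\subseteq V(F)$. Let $C_1,\dots,C_n$ be (the vertex sets of) the connected components of $F-S$ and $D_1,\dots,D_m$ those of $G-\phi(S)$. If $n>m$, then there exist a proper subset $I\subsetneq[n]$ and a minor $F'$ of the graph obtained from $F[C\cup S]$ by adding all edges between distinct vertices of $S$, where $C\coloneqq\bigcup_{i\in I}C_i$, such that $F'$ admits an oddomorphism to $G$.
   Context: All graphs are finite, simple, undirected and loopless. Let $\phi\colon F\to G$ be a homomorphism. A vertex $a\in V(F)$ is $\phi$-odd (resp. $\phi$-even) if $|N_F(a)\cap\phi^{ -1}(v)|$ is odd (resp. even) for every $v\in N_G(\phi(a))$. $\phi$ is an oddomorphism if every vertex of $F$ is $\phi$-odd or $\phi$-even and, for every $v\in V(G)$, the fibre $\phi^{ -1}(v)$ contains an odd number of $\phi$-odd vertices. -}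

module Defs where

open import Data.Nat using (ℕ; zero; suc; _+_; _%_)
open import Data.Bool using (Bool; true; false; _∧_; _∨_; not; if_then_else_)
open import Data.Fin using (Fin; zero; suc; _≟_)
open import Data.Product using (Σ; ∃; _×_; _,_)
open import Function using (_∘_)
open import Function.Bundles using (_⇔_)
open import Relation.Nullary.Decidable using (⌊_⌋)
open import Relation.Binary.PropositionalEquality using (_≡_)

record Graph (n : ℕ) : Set where
  field
    adj    : Fin n → Fin n → Bool
    sym    : ∀ x y → adj x y ≡ adj y x
    irrefl : ∀ x → adj x x ≡ false
open Graph public

count : ∀ {n} → (Fin n → Bool) → ℕ
count {zero}  p = 0
count {suc n} p = (if p zero then 1 else 0) + count (p ∘ suc)

allFin : ∀ {n} → (Fin n → Bool) → Bool
allFin {zero}  p = true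
allFin {suc n} p = p zero ∧ allFin (p ∘ suc)

anyFin : ∀ {n} → (Fin n → Bool) → Bool
anyFin {zero}  p = false
anyFin {suc n} p = p zero ∨ anyFin (p ∘ suc)

isOddℕ : ℕ → Bool
isOddℕ n with n % 2
... | zero  = false
... | suc _ = true

module _ {a b : ℕ} (F : Graph a) (G : Graph b) where

  IsHom : (Fin a → Fin b) → Set
  IsHom φ = ∀ x y → adj F x y ≡ true → adj G (φ x) (φ y) ≡ true

  nbrCount : (Fin a → Fin b) → Fin a → Fin b → ℕ
  nbrCount φ x v = count (λ y → adj F x y ∧ ⌊ φ y ≟ v ⌋)

  oddV : (Fin a → Fin b) → Fin a → Bool
  oddV φ x = allFin (λ v → not (adj G (φ x) v) ∨ isOddℕ (nbrCount φ x v))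

  evenV : (Fin a → Fin b) → Fin a → Bool
  evenV φ x = allFin (λ v → not (adj G (φ x) v) ∨ not (isOddℕ (nbrCount φ x v)))

  IsOddomorphism : (Fin a → Fin b) → Set
  IsOddomorphism φ =
    IsHom φ
    × (∀ x → (oddV φ x ≡ true) ⊎' (evenV φ x ≡ true))
    × (∀ v → isOddℕ (count (λ x → ⌊ φ x ≟ v ⌋ ∧ oddV φ x)) ≡ true)
    where
      open import Data.Sum using () renaming (_⊎_ to _⊎'_)

data Reach {n : ℕ} (adj' : Fin n → Fin n → Bool) (P : Fin n → Bool) : Fin n → Fin n → Set where
  here : ∀ {x} → P x ≡ true → Reach adj' P x x
  step : ∀ {x z y} → P x ≡ true → adj' x z ≡ true → Reach adj' P z y → Reach adj' P x y

-- lab labels the connected components of the graph (adj restricted to P)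
-- by Fin c: C_i = { x | P x, lab x ≡ i }.
IsComponentLabelling : ∀ {n} → Graph n → (P : Fin n → Bool) → (c : ℕ) → (Fin n → Fin c) → Set
IsComponentLabelling {n} G P c lab =
  (∀ x y → P x ≡ true → P y ≡ true → (lab x ≡ lab y) ⇔ Reach (adj G) P x y)
  × (∀ i → ∃ λ x → P x ≡ true × lab x ≡ i)

image : ∀ {a b} → (Fin a → Fin b) → (Fin a → Bool) → Fin b → Bool
image φ S v = anyFin (λ x → S x ∧ ⌊ φ x ≟ v ⌋)

addClique : ∀ {a} → Graph a → (Fin a → Bool) → Fin a → Fin a → Bool
addClique F S x y = (S x ∧ S y ∧ not ⌊ x ≟ y ⌋) ∨ adj F x y

record MinorModel {a k : ℕ} (adjH : Fin a → Fin a → Bool) (U : Fin a → Bool) (F' : Graph k) : Set where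
  field
    branch    : Fin k → Fin a → Bool
    inside    : ∀ u x → branch u x ≡ true → U x ≡ true
    nonempty  : ∀ u → ∃ λ x → branch u x ≡ true
    disjoint  : ∀ u w x → branch u x ≡ true → branch w x ≡ true → u ≡ w
    connected : ∀ u x y → branch u x ≡ true → branch u y ≡ true → Reach adjH (branch u) x y
    edges     : ∀ u w → adj F' u w ≡ true →
                ∃ λ x → ∃ λ y → branch u x ≡ true × branch w y ≡ true × adjH x y ≡ true

-- For a component C_i of F − S and a vertex w ∉ φ(S), let π_i(w) be the parity of the
-- number of φ-odd vertices of C_i over w.  Double counting the edges between the parts of
-- C_i over two adjacent vertices of G − φ(S) shows that π_i is constant on the components
-- of G − φ(S), so C_i yields a vector in 𝔽₂^m.  Since n > m these vectors are linearly
-- dependent: the components in some nonempty J have vectors summing to 0.  As the π_i(w)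
-- of all components sum to 1, the union C of the components outside J has an odd number
-- of odd vertices over every w ∉ φ(S).  Now contract each fibre S ∩ φ⁻¹(v), a clique of
-- the graph F[C ∪ S] + clique on S, to a vertex mapped to v, join x ∈ C to it when x has
-- an odd number of neighbours in that fibre, and choose the edges between contracted
-- vertices so that every contracted vertex has the parity needed for the fibres of the
-- resulting map to contain an odd number of odd vertices.

module Submission where

open import Defs renaming (sym to adj-sym; irrefl to adj-irrefl)
open import Algebra.Bundles using (CommutativeRing; CommutativeMonoid)
open import Data.Bool using (Bool; true; false; _∧_; _∨_; not; _xor_)
open import Data.Bool.Properties
  using (xor-∧-commutativeRing; ∧-commutativeMonoid; ∧-zeroʳ; ∧-identityʳ; ∨-zeroʳ; xor-identityʳ;
         not-involutive; not-injective; xor-same; xor-assoc; ∧-distribˡ-xor; ∧-assoc; ¬-not; ∧-conicalˡ; ∧-conicalʳ)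
  renaming (_≟_ to _≟ᵇ_)
open import Data.Empty using (⊥; ⊥-elim)
open import Data.Fin using (Fin; zero; suc; _≟_; splitAt; join; punchIn)
open import Data.Fin.Properties using (suc-injective; join-splitAt; punchInᵢ≢i; any?)
open import Data.Nat using (ℕ; zero; suc; _+_; _%_; _<_; _>_; s≤s)
open import Data.Nat.DivMod using ([m+n]%n≡m%n)
open import Data.Nat.Properties using (+-comm; m<n⇒m<1+n)
open import Data.Product using (∃; _×_; _,_; proj₁; proj₂)
open import Function.Bundles using (Equivalence)
open import Data.Sum using (_⊎_; inj₁; inj₂)
import Data.Sum as Sum
open import Data.Sum.Properties using (inj₁-injective; inj₂-injective)
open import Function using (_∘_; id)
open import Data.Vec.Functional using (insertAt)
open import Data.Vec.Functional.Properties using (insertAt-lookup; insertAt-punchIn)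
open import Relation.Nullary using (yes; no; contradiction)
open import Relation.Nullary.Decidable using (⌊_⌋)
open import Relation.Binary.PropositionalEquality
open import Algebra.Properties.Semiring.Sum (CommutativeRing.semiring xor-∧-commutativeRing)
  using (sum; sum-cong-≗; sum-replicate-zero; sum-remove; ∑-distrib-+; ∑-comm; *-distribˡ-sum; *-distribʳ-sum)
open import Algebra.Properties.CommutativeSemigroup
  (CommutativeMonoid.commutativeSemigroup (CommutativeRing.+-commutativeMonoid xor-∧-commutativeRing))
  using () renaming (xy∙z≈xz∙y to xor-xy∙z≈xz∙y)
open import Algebra.Properties.CommutativeSemigroup
  (CommutativeMonoid.commutativeSemigroup ∧-commutativeMonoid)
  using () renaming (x∙yz≈y∙xz to ∧-x∙yz≈y∙xz; x∙yz≈z∙yx to ∧-x∙yz≈z∙yx;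
                     x∙yz≈yx∙z to ∧-x∙yz≈yx∙z; x∙yz≈xz∙y to ∧-x∙yz≈xz∙y)

not-∨-elim : ∀ {p q} → p ≡ true → (not p ∨ q) ≡ true → q ≡ true
not-∨-elim refl q≡true = q≡true

xor≡false⇒≡ : ∀ {x y} → x xor y ≡ false → x ≡ y
xor≡false⇒≡ {true}  {true}  _ = refl
xor≡false⇒≡ {false} {false} _ = refl

not-∧-xor : ∀ x y → not x ∧ y ≡ y xor (x ∧ y)
not-∧-xor true  y = sym (xor-same y)
not-∧-xor false y = sym (xor-identityʳ y)

xor≡true⇒≡not : ∀ {x y} → x xor y ≡ true → y ≡ not x
xor≡true⇒≡not {true}  {false} _ = refl
xor≡true⇒≡not {false} {true}  _ = refl

xor-not-xor : ∀ x y → x xor not (y xor x) ≡ not y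
xor-not-xor true  true  = refl
xor-not-xor true  false = refl
xor-not-xor false true  = refl
xor-not-xor false false = refl

xor-∨-not : ∀ h x → x xor ((h ∨ not x) ∧ not x) ≡ true
xor-∨-not true  true  = refl
xor-∨-not true  false = refl
xor-∨-not false true  = refl
xor-∨-not false false = refl

infix 4 _==_
_==_ : ∀ {n} → Fin n → Fin n → Bool
x == y = ⌊ x ≟ y ⌋

==-refl : ∀ {n} (x : Fin n) → (x == x) ≡ true
==-refl x with x ≟ x
... | yes _  = refl
... | no x≢x = ⊥-elim (x≢x refl)

==⇒≡ : ∀ {n} {x y : Fin n} → (x == y) ≡ true → x ≡ y
==⇒≡ {x = x} {y} _ with x ≟ y
==⇒≡ _  | yes x≡y = x≡y
==⇒≡ () | no _

≢⇒==false : ∀ {n} {x y : Fin n} → x ≢ y → (x == y) ≡ false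
≢⇒==false {x = x} {y} x≢y with x ≟ y
... | yes x≡y = ⊥-elim (x≢y x≡y)
... | no _    = refl

-- Parity sums

sum-false : ∀ {n} (f : Fin n → Bool) → (∀ i → f i ≡ false) → sum f ≡ false
sum-false {n} f f≡false = trans (sum-cong-≗ f≡false) (sum-replicate-zero n)

sum-pick : ∀ {n} (f : Fin n → Bool) (i : Fin n) → (∀ j → j ≢ i → f j ≡ false) → sum f ≡ f i
sum-pick {suc n} f i off = begin
  sum f                        ≡⟨ sum-remove {i = i} f ⟩
  f i xor sum (f ∘ punchIn i)  ≡⟨ cong (f i xor_) (sum-false _ (λ j → off _ (punchInᵢ≢i i j))) ⟩
  f i xor false                ≡⟨ xor-identityʳ (f i) ⟩
  f i                          ∎
  where open ≡-Reasoning

sum-pick-== : ∀ {n} (f : Fin n → Bool) (i : Fin n) → sum (λ j → f j ∧ (j == i)) ≡ f i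
sum-pick-== f i = trans (sum-pick _ i off) (trans (cong (f i ∧_) (==-refl i)) (∧-identityʳ (f i)))
  where
  off : ∀ j → j ≢ i → f j ∧ (j == i) ≡ false
  off j j≢i = trans (cong (f j ∧_) (≢⇒==false j≢i)) (∧-zeroʳ (f j))

sum-pick-∧== : ∀ {n} (f g : Fin n → Bool) (i : Fin n) → sum (λ j → f j ∧ (g j ∧ (j == i))) ≡ f i ∧ g i
sum-pick-∧== f g i =
  trans (sum-cong-≗ (λ j → sym (∧-assoc (f j) (g j) (j == i)))) (sum-pick-== (λ j → f j ∧ g j) i)

sum-true⇒∃ : ∀ {n} (f : Fin n → Bool) → sum f ≡ true → ∃ λ i → f i ≡ true
sum-true⇒∃ {suc n} f sum≡true with f zero in f₀
... | true  = zero , f₀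
... | false = let i , fi = sum-true⇒∃ (f ∘ suc) sum≡true in suc i , fi

sum⊎ : ∀ {a b} → (Fin a ⊎ Fin b → Bool) → Bool
sum⊎ g = sum (g ∘ inj₁) xor sum (g ∘ inj₂)

sum-splitAt : ∀ a {b} (g : Fin a ⊎ Fin b → Bool) → sum (g ∘ splitAt a) ≡ sum⊎ g
sum-splitAt zero    g = refl
sum-splitAt (suc a) g = trans (cong (g (inj₁ zero) xor_) (sum-splitAt a (g ∘ Sum.map₁ suc)))
  (sym (xor-assoc (g (inj₁ zero)) _ _))

isOddℕ-% : ∀ m n → m % 2 ≡ n % 2 → isOddℕ m ≡ isOddℕ n
isOddℕ-% m n eq with m % 2 | n % 2
isOddℕ-% m n refl | zero  | .zero    = refl
isOddℕ-% m n refl | suc _ | .(suc _) = refl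

isOddℕ-suc : ∀ n → isOddℕ (suc n) ≡ not (isOddℕ n)
isOddℕ-suc zero    = refl
isOddℕ-suc (suc n) = begin
  isOddℕ (2 + n)             ≡⟨ isOddℕ-% (2 + n) n (trans (cong (_% 2) (+-comm 2 n)) ([m+n]%n≡m%n n 2)) ⟩
  isOddℕ n                   ≡⟨ not-involutive (isOddℕ n) ⟨
  not (not (isOddℕ n))       ≡⟨ cong not (isOddℕ-suc n) ⟨
  not (isOddℕ (suc n))       ∎
  where open ≡-Reasoning

isOddℕ-count : ∀ {n} (p : Fin n → Bool) → isOddℕ (count p) ≡ sum p
isOddℕ-count {zero}  p = refl
isOddℕ-count {suc n} p with p zero
... | true  = trans (isOddℕ-suc (count (p ∘ suc))) (cong not (isOddℕ-count (p ∘ suc)))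
... | false = isOddℕ-count (p ∘ suc)

allFin-cong : ∀ {n} {p q : Fin n → Bool} → (∀ x → p x ≡ q x) → allFin p ≡ allFin q
allFin-cong {zero}  p≡q = refl
allFin-cong {suc n} p≡q = cong₂ _∧_ (p≡q zero) (allFin-cong (p≡q ∘ suc))

allFin-intro : ∀ {n} (p : Fin n → Bool) → (∀ x → p x ≡ true) → allFin p ≡ true
allFin-intro {n} p p≡true = trans (allFin-cong p≡true) (allTrue n)
  where
  allTrue : ∀ n → allFin {n} (λ _ → true) ≡ true
  allTrue zero    = refl
  allTrue (suc n) = allTrue n

allFin-elim : ∀ {n} (p : Fin n → Bool) → allFin p ≡ true → ∀ x → p x ≡ true
allFin-elim {suc n} p all x with p zero in p₀
allFin-elim {suc n} p all zero    | true = p₀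
allFin-elim {suc n} p all (suc x) | true = allFin-elim (p ∘ suc) all x

allFin-not-∨ : ∀ {n} (q : Fin n → Bool) c → allFin (λ v → not (q v) ∨ c) ≡ not (anyFin q) ∨ c
allFin-not-∨ {zero}  q c = refl
allFin-not-∨ {suc n} q c with q zero
... | true  = trans (cong (c ∧_) (allFin-not-∨ (q ∘ suc) c)) (absorb c _)
  where
  absorb : ∀ c b → c ∧ (b ∨ c) ≡ c
  absorb true  b = ∨-zeroʳ b
  absorb false b = refl
... | false = allFin-not-∨ (q ∘ suc) c

anyFin-intro : ∀ {n} (p : Fin n → Bool) x → p x ≡ true → anyFin p ≡ true
anyFin-intro p zero    px = cong (_∨ anyFin (p ∘ suc)) px
anyFin-intro p (suc x) px = trans (cong (p zero ∨_) (anyFin-intro (p ∘ suc) x px)) (∨-zeroʳ (p zero))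

anyFin-elim : ∀ {n} (p : Fin n → Bool) → anyFin p ≡ true → ∃ λ x → p x ≡ true
anyFin-elim {suc n} p any with p zero in p₀
... | true  = zero , p₀
... | false = let x , px = anyFin-elim (p ∘ suc) any in suc x , px

anyFin-false : ∀ {n} (p : Fin n → Bool) → anyFin p ≡ false → ∀ x → p x ≡ false
anyFin-false {suc n} p none x with p zero in p₀
anyFin-false {suc n} p none zero    | false = p₀
anyFin-false {suc n} p none (suc x) | false = anyFin-false (p ∘ suc) none x

-- Oddomorphisms in terms of parities

-- o x records whether x is to be odd; the parity conditions only count vertices in T.
record OddParities {X : Set} (∑ : (X → Bool) → Bool) (T : X → Bool) (A : X → X → Bool)
                   {b} (G : Graph b) (φ : X → Fin b) (o : X → Bool) : Set where
  field
    hom      : ∀ x y → T x ≡ true → T y ≡ true → A x y ≡ true → adj G (φ x) (φ y) ≡ true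
    nbr      : ∀ x → T x ≡ true → ∀ w → adj G (φ x) w ≡ true →
               ∑ (λ y → T y ∧ (A x y ∧ (φ y == w))) ≡ o x
    isolated : ∀ x → T x ≡ true → anyFin (adj G (φ x)) ≡ false → o x ≡ true
    fibre    : ∀ v → ∑ (λ x → T x ∧ ((φ x == v) ∧ o x)) ≡ true

module _ {a b} (F : Graph a) (G : Graph b) (φ : Fin a → Fin b) where

  isOdd-nbrCount : ∀ x w → isOddℕ (nbrCount F G φ x w) ≡ sum (λ y → adj F x y ∧ (φ y == w))
  isOdd-nbrCount x w = isOddℕ-count (λ y → adj F x y ∧ (φ y == w))

  isOdd-fibreCount : ∀ (o : Fin a → Bool) v →
                     isOddℕ (count (λ x → (φ x == v) ∧ o x)) ≡ sum (λ x → (φ x == v) ∧ o x)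
  isOdd-fibreCount o v = isOddℕ-count (λ x → (φ x == v) ∧ o x)

  oddomorphism⇒parities : IsOddomorphism F G φ →
                          OddParities sum (λ _ → true) (adj F) G φ (oddV F G φ)
  oddomorphism⇒parities (hom , oddOrEven , fibres) = record
    { hom      = λ x y _ _ → hom x y
    ; nbr      = λ x _ → nbr x
    ; isolated = λ x _ → isolated x
    ; fibre    = λ v → trans (sym (isOdd-fibreCount (oddV F G φ) v)) (fibres v)
    }
    where
    oddAt : ∀ {x} → oddV F G φ x ≡ true → ∀ w → adj G (φ x) w ≡ true → isOddℕ (nbrCount F G φ x w) ≡ true
    oddAt {x} odd w x~w = not-∨-elim x~w
      (allFin-elim (λ v → not (adj G (φ x) v) ∨ isOddℕ (nbrCount F G φ x v)) odd w)
    evenAt : ∀ {x} → evenV F G φ x ≡ true → ∀ w → adj G (φ x) w ≡ true → isOddℕ (nbrCount F G φ x w) ≡ false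
    evenAt {x} even w x~w = not-injective (not-∨-elim x~w
      (allFin-elim (λ v → not (adj G (φ x) v) ∨ not (isOddℕ (nbrCount F G φ x v))) even w))
    nbr : ∀ x w → adj G (φ x) w ≡ true → sum (λ y → adj F x y ∧ (φ y == w)) ≡ oddV F G φ x
    nbr x w x~w with oddOrEven x
    ... | inj₁ odd  = trans (sym (isOdd-nbrCount x w)) (trans (oddAt odd w x~w) (sym odd))
    ... | inj₂ even = trans (sym (isOdd-nbrCount x w)) (trans (evenAt even w x~w) (sym notOdd))
      where
      notOdd : oddV F G φ x ≡ false
      notOdd with oddV F G φ x in odd
      ... | false = refl
      ... | true  = contradiction (trans (sym (oddAt odd w x~w)) (evenAt even w x~w)) λ ()
    isolated : ∀ x → anyFin (adj G (φ x)) ≡ false → oddV F G φ x ≡ true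
    isolated x none = allFin-intro _ (λ w → cong (λ e → not e ∨ isOddℕ (nbrCount F G φ x w))
                                                  (anyFin-false (adj G (φ x)) none w))

  parities⇒oddomorphism : ∀ {o} → OddParities sum (λ _ → true) (adj F) G φ o → IsOddomorphism F G φ
  parities⇒oddomorphism {o} P = (λ x y → hom x y refl refl) , oddOrEven , fibres
    where
    open OddParities P
    atNbrs : ∀ x (f : Bool → Bool) w →
             (not (adj G (φ x) w) ∨ f (isOddℕ (nbrCount F G φ x w))) ≡ (not (adj G (φ x) w) ∨ f (o x))
    atNbrs x f w with adj G (φ x) w in x~w
    ... | false = refl
    ... | true  = cong f (trans (isOdd-nbrCount x w) (nbr x refl w x~w))
    oddV≡o : ∀ x → oddV F G φ x ≡ o x
    oddV≡o x = trans (allFin-cong (atNbrs x id))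
      (trans (allFin-not-∨ (adj G (φ x)) (o x)) (lonely (anyFin (adj G (φ x))) refl))
      where
      lonely : ∀ h → anyFin (adj G (φ x)) ≡ h → (not h ∨ o x) ≡ o x
      lonely true  _    = refl
      lonely false none = sym (isolated x refl none)
    evenV-true : ∀ x → o x ≡ false → evenV F G φ x ≡ true
    evenV-true x ox = trans (allFin-cong (atNbrs x not))
      (trans (allFin-not-∨ (adj G (φ x)) (not (o x)))
        (trans (cong (λ e → not (anyFin (adj G (φ x))) ∨ not e) ox) (∨-zeroʳ _)))
    oddOrEven : ∀ x → oddV F G φ x ≡ true ⊎ evenV F G φ x ≡ true
    oddOrEven x with o x in ox
    ... | true  = inj₁ (trans (oddV≡o x) ox)
    ... | false = inj₂ (evenV-true x ox)
    fibres : ∀ v → isOddℕ (count (λ x → (φ x == v) ∧ oddV F G φ x)) ≡ true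
    fibres v = trans (isOdd-fibreCount (oddV F G φ) v)
      (trans (sum-cong-≗ (λ x → cong ((φ x == v) ∧_) (oddV≡o x))) (fibre v))

-- Induced graphs on enumerated vertex sets

record Enumeration {X : Set} (∑ : (X → Bool) → Bool) (T : X → Bool) : Set where
  field
    size      : ℕ
    index     : Fin size → X
    injective : ∀ u w → index u ≡ index w → u ≡ w
    index-∈   : ∀ u → T (index u) ≡ true
    sum-index : ∀ f → sum (f ∘ index) ≡ ∑ (λ x → T x ∧ f x)

enumerate : ∀ {N} (T : Fin N → Bool) → Enumeration sum T
enumerate {zero}  T = record
  { size = 0 ; index = λ () ; injective = λ () ; index-∈ = λ () ; sum-index = λ _ → refl }
enumerate {suc N} T with T zero in T₀
... | true = record
  { size = suc size ; index = index′ ; injective = injective′ ; index-∈ = index-∈′ ; sum-index = sum-index′ }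
  where
  open Enumeration (enumerate (T ∘ suc))
  index′ : Fin (suc size) → Fin (suc N)
  index′ zero    = zero
  index′ (suc u) = suc (index u)
  injective′ : ∀ u w → index′ u ≡ index′ w → u ≡ w
  injective′ zero    zero    _  = refl
  injective′ (suc u) (suc w) eq = cong suc (injective u w (suc-injective eq))
  index-∈′ : ∀ u → T (index′ u) ≡ true
  index-∈′ zero    = T₀
  index-∈′ (suc u) = index-∈ u
  sum-index′ : ∀ f → sum (f ∘ index′) ≡ sum (λ x → T x ∧ f x)
  sum-index′ f rewrite T₀ = cong (f zero xor_) (sum-index (f ∘ suc))
... | false = record
  { size = size ; index = suc ∘ index ; injective = λ u w eq → injective u w (suc-injective eq)
  ; index-∈ = index-∈ ; sum-index = sum-index′ }
  where
  open Enumeration (enumerate (T ∘ suc))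
  sum-index′ : ∀ f → sum (f ∘ suc ∘ index) ≡ sum (λ x → T x ∧ f x)
  sum-index′ f rewrite T₀ = sum-index (f ∘ suc)

enumerate⊎ : ∀ {a b} (T : Fin a ⊎ Fin b → Bool) → Enumeration sum⊎ T
enumerate⊎ T = record
  { size = size₁ + size₂ ; index = index ; injective = injective ; index-∈ = index-∈ ; sum-index = sum-index }
  where
  open Enumeration (enumerate (T ∘ inj₁)) renaming
    (size to size₁; index to index₁; injective to injective₁; index-∈ to index-∈₁; sum-index to sum-index₁)
  open Enumeration (enumerate (T ∘ inj₂)) renaming
    (size to size₂; index to index₂; injective to injective₂; index-∈ to index-∈₂; sum-index to sum-index₂)
  index : Fin (size₁ + size₂) → _
  index u = Sum.map index₁ index₂ (splitAt size₁ u)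
  map-injective : ∀ s t → Sum.map index₁ index₂ s ≡ Sum.map index₁ index₂ t → s ≡ t
  map-injective (inj₁ k) (inj₁ l) eq = cong inj₁ (injective₁ k l (inj₁-injective eq))
  map-injective (inj₂ k) (inj₂ l) eq = cong inj₂ (injective₂ k l (inj₂-injective eq))
  injective : ∀ u w → index u ≡ index w → u ≡ w
  injective u w eq = begin
    u
      ≡⟨ join-splitAt size₁ size₂ u ⟨
    join size₁ size₂ (splitAt size₁ u)
      ≡⟨ cong (join size₁ size₂) (map-injective (splitAt size₁ u) (splitAt size₁ w) eq) ⟩
    join size₁ size₂ (splitAt size₁ w)
      ≡⟨ join-splitAt size₁ size₂ w ⟩
    w
      ∎
    where open ≡-Reasoning
  index-∈ : ∀ u → T (index u) ≡ true
  index-∈ u with splitAt size₁ u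
  ... | inj₁ k = index-∈₁ k
  ... | inj₂ k = index-∈₂ k
  sum-index : ∀ f → sum (f ∘ index) ≡ sum⊎ (λ x → T x ∧ f x)
  sum-index f = trans (sum-splitAt size₁ (f ∘ Sum.map index₁ index₂))
                      (cong₂ _xor_ (sum-index₁ (f ∘ inj₁)) (sum-index₂ (f ∘ inj₂)))

record MinorModelOn {X : Set} (T : X → Bool) (A : X → X → Bool)
                    {a} (H : Fin a → Fin a → Bool) (U : Fin a → Bool) : Set where
  field
    branch    : X → Fin a → Bool
    inside    : ∀ z x → T z ≡ true → branch z x ≡ true → U x ≡ true
    nonempty  : ∀ z → T z ≡ true → ∃ λ x → branch z x ≡ true
    disjoint  : ∀ z z′ x → T z ≡ true → T z′ ≡ true → branch z x ≡ true → branch z′ x ≡ true → z ≡ z′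
    connected : ∀ z x y → T z ≡ true → branch z x ≡ true → branch z y ≡ true → Reach H (branch z) x y
    edges     : ∀ z z′ → T z ≡ true → T z′ ≡ true → A z z′ ≡ true →
                ∃ λ x → ∃ λ y → branch z x ≡ true × branch z′ y ≡ true × H x y ≡ true

module Induced {X : Set} {∑ : (X → Bool) → Bool} {T : X → Bool} (E : Enumeration ∑ T)
               (A : X → X → Bool) (A-sym : ∀ x y → A x y ≡ A y x) (A-irrefl : ∀ x → A x x ≡ false) where

  open Enumeration E

  graph : Graph size
  graph = record
    { adj = λ u w → A (index u) (index w) ; sym = λ u w → A-sym (index u) (index w) ; irrefl = A-irrefl ∘ index }

  oddomorphism : ∀ {b} {G : Graph b} {φ : X → Fin b} {o} → OddParities ∑ T A G φ o → IsOddomorphism graph G (φ ∘ index)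
  oddomorphism {G = G} {φ} P = parities⇒oddomorphism graph G (φ ∘ index) (record
    { hom      = λ u w _ _ → hom (index u) (index w) (index-∈ u) (index-∈ w)
    ; nbr      = λ u _ w u~w → trans (sum-index _) (nbr (index u) (index-∈ u) w u~w)
    ; isolated = λ u _ → isolated (index u) (index-∈ u)
    ; fibre    = λ v → trans (sum-index _) (fibre v)
    })
    where open OddParities P

  minorModel : ∀ {a} {H : Fin a → Fin a → Bool} {U} → MinorModelOn T A H U → MinorModel H U graph
  minorModel M = record
    { branch    = branch ∘ index
    ; inside    = λ u x → inside (index u) x (index-∈ u)
    ; nonempty  = λ u → nonempty (index u) (index-∈ u)
    ; disjoint  = λ u w x ux wx → injective u w (disjoint (index u) (index w) x (index-∈ u) (index-∈ w) ux wx)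
    ; connected = λ u x y → connected (index u) x y (index-∈ u)
    ; edges     = λ u w → edges (index u) (index w) (index-∈ u) (index-∈ w)
    }
    where open MinorModelOn M

-- Linear dependence over 𝔽₂

LinearlyDependent : ∀ {n m} → (Fin n → Fin m → Bool) → Set
LinearlyDependent {n} V =
  ∃ λ (J : Fin n → Bool) → (∃ λ i → J i ≡ true) × (∀ j → sum (λ i → J i ∧ V i j) ≡ false)

dependent-zeroColumn : ∀ {n m} (V : Fin n → Fin (suc m) → Bool) → (∀ i → V i zero ≡ false) →
                       LinearlyDependent (λ i j → V i (suc j)) → LinearlyDependent V
dependent-zeroColumn V column (J , nonzero , vanish) = J , nonzero , λ where
  zero    → sum-false _ (λ i → trans (cong (J i ∧_) (column i)) (∧-zeroʳ (J i)))
  (suc j) → vanish j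

-- One step of Gaussian elimination, pivoting on the entry V i₀ zero.
eliminate : ∀ {n m} → (Fin (suc n) → Fin (suc m) → Bool) → Fin (suc n) → Fin n → Fin m → Bool
eliminate V i₀ k j = V (punchIn i₀ k) (suc j) xor (V (punchIn i₀ k) zero ∧ V i₀ (suc j))

sum-insertAt : ∀ {n} (J : Fin n → Bool) (i₀ : Fin (suc n)) c (W : Fin (suc n) → Bool) →
               sum (λ i → insertAt J i₀ c i ∧ W i) ≡ (c ∧ W i₀) xor sum (λ k → J k ∧ W (punchIn i₀ k))
sum-insertAt J i₀ c W = trans (sum-remove {i = i₀} (λ i → insertAt J i₀ c i ∧ W i))
  (cong₂ _xor_ (cong (_∧ W i₀) (insertAt-lookup J i₀ c))
               (sum-cong-≗ (λ k → cong (_∧ W (punchIn i₀ k)) (insertAt-punchIn J i₀ c k))))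

dependent-pivot : ∀ {n m} (V : Fin (suc n) → Fin (suc m) → Bool) (i₀ : Fin (suc n)) → V i₀ zero ≡ true →
                  LinearlyDependent (eliminate V i₀) → LinearlyDependent V
dependent-pivot V i₀ pivot (J′ , (k , J′k) , vanish′) =
  insertAt J′ i₀ c , (punchIn i₀ k , trans (insertAt-punchIn J′ i₀ c k) J′k) , vanish
  where
  open ≡-Reasoning
  c : Bool
  c = sum (λ k → J′ k ∧ V (punchIn i₀ k) zero)
  vanish : ∀ j → sum (λ i → insertAt J′ i₀ c i ∧ V i j) ≡ false
  vanish zero = begin
    sum (λ i → insertAt J′ i₀ c i ∧ V i zero) ≡⟨ sum-insertAt J′ i₀ c (λ i → V i zero) ⟩
    (c ∧ V i₀ zero) xor c                     ≡⟨ cong (λ t → (c ∧ t) xor c) pivot ⟩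
    (c ∧ true) xor c                          ≡⟨ cong (_xor c) (∧-identityʳ c) ⟩
    c xor c                                   ≡⟨ xor-same c ⟩
    false                                     ∎
  vanish (suc j) = begin
    sum (λ i → insertAt J′ i₀ c i ∧ V i (suc j)) ≡⟨ sum-insertAt J′ i₀ c (λ i → V i (suc j)) ⟩
    (c ∧ d) xor X                                ≡⟨ cong ((c ∧ d) xor_) (xor≡false⇒≡ (trans (sym expand) (vanish′ j))) ⟩
    (c ∧ d) xor (c ∧ d)                          ≡⟨ xor-same (c ∧ d) ⟩
    false                                        ∎
    where
    d X : Bool
    d = V i₀ (suc j)
    X = sum (λ k → J′ k ∧ V (punchIn i₀ k) (suc j))
    expand : sum (λ k → J′ k ∧ eliminate V i₀ k j) ≡ X xor (c ∧ d)
    expand = begin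
      sum (λ k → J′ k ∧ eliminate V i₀ k j)
        ≡⟨ sum-cong-≗ (λ k → ∧-distribˡ-xor (J′ k) _ _) ⟩
      sum (λ k → (J′ k ∧ V (punchIn i₀ k) (suc j)) xor (J′ k ∧ (V (punchIn i₀ k) zero ∧ d)))
        ≡⟨ ∑-distrib-+ (λ k → J′ k ∧ V (punchIn i₀ k) (suc j)) _ ⟩
      X xor sum (λ k → J′ k ∧ (V (punchIn i₀ k) zero ∧ d))
        ≡⟨ cong (X xor_) (sum-cong-≗ (λ k → sym (∧-assoc (J′ k) _ d))) ⟩
      X xor sum (λ k → (J′ k ∧ V (punchIn i₀ k) zero) ∧ d)
        ≡⟨ cong (X xor_) (*-distribʳ-sum d (λ k → J′ k ∧ V (punchIn i₀ k) zero)) ⟨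
      X xor (c ∧ d)
        ∎

linearlyDependent : ∀ {n m} (V : Fin n → Fin m → Bool) → m < n → LinearlyDependent V
linearlyDependent {suc n} {zero}  V _ = (λ _ → true) , (zero , refl) , λ ()
linearlyDependent {suc n} {suc m} V (s≤s m<n) with any? (λ i → V i zero ≟ᵇ true)
... | yes (i₀ , pivot) = dependent-pivot V i₀ pivot (linearlyDependent (eliminate V i₀) m<n)
... | no  noPivot      = dependent-zeroColumn V (λ i → ¬-not (λ pivot → noPivot (i , pivot)))
                           (linearlyDependent (λ i j → V i (suc j)) (m<n⇒m<1+n m<n))

-- Parity vectors of the components of F − S

module ComponentParities
  {a b : ℕ} (F : Graph a) (G : Graph b) (φ : Fin a → Fin b) (odm : IsOddomorphism F G φ) (S : Fin a → Bool)
  (n : ℕ) (labF : Fin a → Fin n) (compF : IsComponentLabelling F (λ x → not (S x)) n labF)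
  (m : ℕ) (labG : Fin b → Fin m) (compG : IsComponentLabelling G (λ v → not (image φ S v)) m labG)
  where

  open ≡-Reasoning

  odd : Fin a → Bool
  odd = oddV F G φ

  open OddParities (oddomorphism⇒parities F G φ odm)
    using () renaming (nbr to nbrParity≡odd; isolated to isolated-odd; fibre to fibre-odd)

  img : Fin b → Bool
  img = image φ S

  fib : Fin b → Fin a → Bool
  fib v x = φ x == v

  infixr 7 _∩_
  _∩_ : (Fin a → Bool) → (Fin a → Bool) → Fin a → Bool
  (P ∩ Q) x = P x ∧ Q x

  S-offImage : ∀ {v y} → img v ≡ false → fib v y ≡ true → S y ≡ false
  S-offImage {v} {y} off yv = begin
    S y            ≡⟨ ∧-identityʳ (S y) ⟨
    S y ∧ true     ≡⟨ cong (S y ∧_) yv ⟨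
    S y ∧ fib v y  ≡⟨ anyFin-false (S ∩ fib v) off y ⟩
    false          ∎

  sameComponent : ∀ {x y} → S x ≡ false → S y ≡ false → adj F x y ≡ true → labF x ≡ labF y
  sameComponent {x} {y} Sx Sy x~y =
    Equivalence.from (proj₁ compF x y (cong not Sx) (cong not Sy)) (step (cong not Sx) x~y (here (cong not Sy)))

  unionOf : (Fin n → Bool) → Fin a → Bool
  unionOf g x = not (S x) ∧ g (labF x)

  component : Fin n → Fin a → Bool
  component i = unionOf (_== i)

  nbrParity : (Fin a → Bool) → Fin a → Bool
  nbrParity Q x = sum (λ y → adj F x y ∧ Q y)

  edgeParity : (Fin a → Bool) → (Fin a → Bool) → Bool
  edgeParity R Q = sum (λ x → R x ∧ nbrParity Q x)

  oddParity : (Fin a → Bool) → Fin b → Bool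
  oddParity K w = sum (λ x → K x ∧ (fib w x ∧ odd x))

  edgeParity-sym : ∀ (R Q : Fin a → Bool) → edgeParity R Q ≡ edgeParity Q R
  edgeParity-sym R Q = begin
    sum (λ x → R x ∧ sum (λ y → adj F x y ∧ Q y))    ≡⟨ sum-cong-≗ (λ x → *-distribˡ-sum (R x) (λ y → adj F x y ∧ Q y)) ⟩
    sum (λ x → sum (λ y → R x ∧ (adj F x y ∧ Q y)))  ≡⟨ ∑-comm (λ x y → R x ∧ (adj F x y ∧ Q y)) ⟩
    sum (λ y → sum (λ x → R x ∧ (adj F x y ∧ Q y)))  ≡⟨ sum-cong-≗ (λ y → sum-cong-≗ (λ x → swap x y)) ⟩
    sum (λ y → sum (λ x → Q y ∧ (adj F y x ∧ R x)))  ≡⟨ sum-cong-≗ (λ y → *-distribˡ-sum (Q y) (λ x → adj F y x ∧ R x)) ⟨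
    sum (λ y → Q y ∧ sum (λ x → adj F y x ∧ R x))    ∎
    where
    swap : ∀ x y → R x ∧ (adj F x y ∧ Q y) ≡ Q y ∧ (adj F y x ∧ R x)
    swap x y = trans (∧-x∙yz≈z∙yx (R x) (adj F x y) (Q y)) (cong (λ e → Q y ∧ (e ∧ R x)) (adj-sym F x y))

  -- The neighbours of a vertex of a union of components lie in that union or in S.
  nbrParity-split : ∀ (g : Fin n → Bool) {x} (Q : Fin a → Bool) → unionOf g x ≡ true →
                    nbrParity Q x ≡ nbrParity (unionOf g ∩ Q) x xor nbrParity (S ∩ Q) x
  nbrParity-split g {x} Q Kx = trans (sum-cong-≗ pointwise)
    (∑-distrib-+ (λ y → adj F x y ∧ (unionOf g y ∧ Q y)) (λ y → adj F x y ∧ (S y ∧ Q y)))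
    where
    Sx : S x ≡ false
    Sx = not-injective (∧-conicalˡ _ _ Kx)
    pointwise : ∀ y → adj F x y ∧ Q y ≡ (adj F x y ∧ (unionOf g y ∧ Q y)) xor (adj F x y ∧ (S y ∧ Q y))
    pointwise y with S y in Sy | adj F x y in x~y
    ... | true  | true  = refl
    ... | true  | false = refl
    ... | false | false = refl
    ... | false | true rewrite sym (sameComponent Sx Sy x~y) =
      sym (trans (xor-identityʳ _) (cong (_∧ Q y) (∧-conicalʳ (not (S x)) (g (labF x)) Kx)))

  oddParity-split : ∀ (g : Fin n → Bool) {w v} → adj G w v ≡ true →
    oddParity (unionOf g) w ≡ edgeParity (unionOf g ∩ fib w) (unionOf g ∩ fib v)
                              xor edgeParity (unionOf g ∩ fib w) (S ∩ fib v)
  oddParity-split g {w} {v} w~v = trans (sum-cong-≗ pointwise)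
    (∑-distrib-+ (λ x → (unionOf g ∩ fib w) x ∧ nbrParity (unionOf g ∩ fib v) x)
                 (λ x → (unionOf g ∩ fib w) x ∧ nbrParity (S ∩ fib v) x))
    where
    pointwise : ∀ x → unionOf g x ∧ (fib w x ∧ odd x) ≡
                      ((unionOf g ∩ fib w) x ∧ nbrParity (unionOf g ∩ fib v) x)
                      xor ((unionOf g ∩ fib w) x ∧ nbrParity (S ∩ fib v) x)
    pointwise x with unionOf g x in Kx | fib w x in xw
    ... | false | _     = refl
    ... | true  | false = refl
    ... | true  | true  = trans (sym (nbrParity≡odd x refl v φx~v)) (nbrParity-split g (fib v) Kx)
      where
      φx~v : adj G (φ x) v ≡ true
      φx~v = subst (λ t → adj G t v ≡ true) (sym (==⇒≡ xw)) w~v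

  edgeParity-offImage : ∀ (R : Fin a → Bool) {v} → img v ≡ false → edgeParity R (S ∩ fib v) ≡ false
  edgeParity-offImage R {v} off = sum-false _ λ x →
    trans (cong (R x ∧_) (sum-false _ λ y →
      trans (cong (adj F x y ∧_) (anyFin-false (S ∩ fib v) off y)) (∧-zeroʳ (adj F x y))))
    (∧-zeroʳ (R x))

  oddParity-offImage : ∀ (g : Fin n → Bool) {w v} → adj G w v ≡ true → img v ≡ false →
    oddParity (unionOf g) w ≡ edgeParity (unionOf g ∩ fib w) (unionOf g ∩ fib v)
  oddParity-offImage g {w} {v} w~v off = trans (oddParity-split g w~v)
    (trans (cong (edgeParity (unionOf g ∩ fib w) (unionOf g ∩ fib v) xor_) (edgeParity-offImage (unionOf g ∩ fib w) off))
           (xor-identityʳ _))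

  componentParity-reach : ∀ i {w v} → Reach (adj G) (λ u → not (img u)) w v →
                          oddParity (component i) w ≡ oddParity (component i) v
  componentParity-reach i (here _) = refl
  componentParity-reach i {w} (step {z = v} offw w~v reach) = trans edge (componentParity-reach i reach)
    where
    offv : img v ≡ false
    offv = not-injective (reachStart reach)
      where
      reachStart : ∀ {P u u′} → Reach (adj G) P u u′ → P u ≡ true
      reachStart (here Pu)     = Pu
      reachStart (step Pu _ _) = Pu
    edge : oddParity (component i) w ≡ oddParity (component i) v
    edge = begin
      oddParity (component i) w
        ≡⟨ oddParity-offImage (_== i) w~v offv ⟩
      edgeParity (component i ∩ fib w) (component i ∩ fib v)
        ≡⟨ edgeParity-sym _ _ ⟩
      edgeParity (component i ∩ fib v) (component i ∩ fib w)
        ≡⟨ oddParity-offImage (_== i) (trans (adj-sym G v w) w~v) (not-injective offw) ⟨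
      oddParity (component i) v
        ∎

  sum-unionOf : ∀ (g : Fin n → Bool) (R : Fin a → Bool) → sum (λ i → g i ∧ sum (λ x → component i x ∧ R x)) ≡ sum (λ x → unionOf g x ∧ R x)
  sum-unionOf g R = begin
    sum (λ i → g i ∧ sum (λ x → component i x ∧ R x))
      ≡⟨ sum-cong-≗ (λ i → *-distribˡ-sum (g i) (λ x → component i x ∧ R x)) ⟩
    sum (λ i → sum (λ x → g i ∧ (component i x ∧ R x)))
      ≡⟨ ∑-comm (λ i x → g i ∧ (component i x ∧ R x)) ⟩
    sum (λ x → sum (λ i → g i ∧ (component i x ∧ R x)))
      ≡⟨ sum-cong-≗ (λ x → sum-pick (λ i → g i ∧ (component i x ∧ R x)) (labF x) (off x)) ⟩
    sum (λ x → g (labF x) ∧ (component (labF x) x ∧ R x))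
      ≡⟨ sum-cong-≗ own ⟩
    sum (λ x → unionOf g x ∧ R x)
      ∎
    where
    off : ∀ x i → i ≢ labF x → g i ∧ (component i x ∧ R x) ≡ false
    off x i i≢lx rewrite ≢⇒==false (i≢lx ∘ sym) | ∧-zeroʳ (not (S x)) = ∧-zeroʳ (g i)
    own : ∀ x → g (labF x) ∧ (component (labF x) x ∧ R x) ≡ unionOf g x ∧ R x
    own x rewrite ==-refl (labF x) | ∧-identityʳ (not (S x)) = ∧-x∙yz≈yx∙z (g (labF x)) (not (S x)) (R x)

  componentParity-sum : ∀ {w} → img w ≡ false → sum (λ i → oddParity (component i) w) ≡ true
  componentParity-sum {w} off = trans (sum-unionOf (λ _ → true) (λ x → fib w x ∧ odd x))
                                      (trans (sum-cong-≗ outsideS) (fibre-odd w))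
    where
    outsideS : ∀ x → (not (S x) ∧ true) ∧ (fib w x ∧ odd x) ≡ fib w x ∧ odd x
    outsideS x with fib w x in xw
    ... | false = ∧-zeroʳ _
    ... | true rewrite S-offImage off xw = refl

  representative : Fin m → Fin b
  representative j = proj₁ (proj₂ compG j)

  parityVector : Fin n → Fin m → Bool
  parityVector i j = oddParity (component i) (representative j)

  componentParity≡parityVector : ∀ i {w} → img w ≡ false → oddParity (component i) w ≡ parityVector i (labG w)
  componentParity≡parityVector i {w} off = componentParity-reach i
    (Equivalence.to (proj₁ compG w (representative j) (cong not off) (proj₁ (proj₂ (proj₂ compG j))))
                    (sym (proj₂ (proj₂ (proj₂ compG j)))))
    where j = labG w

  module Contraction (J : Fin n → Bool) (J-vanish : ∀ j → sum (λ i → J i ∧ parityVector i j) ≡ false) where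

    C : Fin a → Bool
    C = unionOf (not ∘ J)

    p : Fin b → Bool
    p = oddParity C

    p-offImage : ∀ {w} → img w ≡ false → p w ≡ true
    p-offImage {w} off = begin
      p w
        ≡⟨ sum-unionOf (not ∘ J) (λ x → fib w x ∧ odd x) ⟨
      sum (λ i → not (J i) ∧ oddParity (component i) w)
        ≡⟨ sum-cong-≗ (λ i → cong (not (J i) ∧_) (componentParity≡parityVector i off)) ⟩
      sum (λ i → not (J i) ∧ parityVector i j)
        ≡⟨ sum-cong-≗ (λ i → not-∧-xor (J i) (parityVector i j)) ⟩
      sum (λ i → parityVector i j xor (J i ∧ parityVector i j))
        ≡⟨ ∑-distrib-+ (λ i → parityVector i j) (λ i → J i ∧ parityVector i j) ⟩
      sum (λ i → parityVector i j) xor sum (λ i → J i ∧ parityVector i j)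
        ≡⟨ cong₂ _xor_ (trans (sum-cong-≗ (λ i → sym (componentParity≡parityVector i off))) (componentParity-sum off))
                       (J-vanish j) ⟩
      true xor false
        ∎
      where j = labG w

    nbrParityS : Fin a → Fin b → Bool
    nbrParityS x v = nbrParity (S ∩ fib v) x

    edgeParityS : Fin b → Fin b → Bool
    edgeParityS w v = edgeParity (C ∩ fib w) (S ∩ fib v)

    p-split : ∀ {w v} → adj G w v ≡ true → p w ≡ edgeParity (C ∩ fib w) (C ∩ fib v) xor edgeParityS w v
    p-split = oddParity-split (not ∘ J)

    -- Makes a contracted vertex v have ¬ p v neighbours over each neighbour w of v, mod 2.
    contractedEdge : Fin b → Fin b → Bool
    contractedEdge v w = not (p v xor edgeParityS w v)

    contractedEdge-sym : ∀ {v w} → adj G v w ≡ true → contractedEdge v w ≡ contractedEdge w v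
    contractedEdge-sym {v} {w} v~w = cong not (begin
      p v xor edgeParityS w v
        ≡⟨ cong (_xor edgeParityS w v) (p-split v~w) ⟩
      (edgeParity (C ∩ fib v) (C ∩ fib w) xor edgeParityS v w) xor edgeParityS w v
        ≡⟨ cong (λ e → (e xor edgeParityS v w) xor edgeParityS w v) (edgeParity-sym _ _) ⟩
      (edgeParity (C ∩ fib w) (C ∩ fib v) xor edgeParityS v w) xor edgeParityS w v
        ≡⟨ xor-xy∙z≈xz∙y (edgeParity (C ∩ fib w) (C ∩ fib v)) (edgeParityS v w) (edgeParityS w v) ⟩
      (edgeParity (C ∩ fib w) (C ∩ fib v) xor edgeParityS w v) xor edgeParityS v w
        ≡⟨ cong (_xor edgeParityS v w) (p-split (trans (adj-sym G w v) v~w)) ⟨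
      p w xor edgeParityS v w
        ∎)

    -- F′ has a vertex inj₁ x for each x ∈ C and a vertex inj₂ v for the contracted fibre
    -- S ∩ φ⁻¹(v); the latter is dropped over an isolated v when p v holds, as it could only be odd.
    T : Fin a ⊎ Fin b → Bool
    T (inj₁ x) = C x
    T (inj₂ v) = img v ∧ (anyFin (adj G v) ∨ not (p v))

    ψ : Fin a ⊎ Fin b → Fin b
    ψ (inj₁ x) = φ x
    ψ (inj₂ v) = v

    o : Fin a ⊎ Fin b → Bool
    o (inj₁ x) = odd x
    o (inj₂ v) = not (p v)

    A : Fin a ⊎ Fin b → Fin a ⊎ Fin b → Bool
    A (inj₁ x) (inj₁ y) = adj F x y
    A (inj₁ x) (inj₂ v) = nbrParityS x v
    A (inj₂ v) (inj₁ x) = nbrParityS x v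
    A (inj₂ v) (inj₂ w) = adj G v w ∧ contractedEdge v w

    A-sym : ∀ z z′ → A z z′ ≡ A z′ z
    A-sym (inj₁ x) (inj₁ y) = adj-sym F x y
    A-sym (inj₁ x) (inj₂ v) = refl
    A-sym (inj₂ v) (inj₁ x) = refl
    A-sym (inj₂ v) (inj₂ w) with adj G v w in v~w
    ... | false = sym (cong (_∧ contractedEdge w v) (trans (adj-sym G w v) v~w))
    ... | true  = trans (contractedEdge-sym v~w) (cong (_∧ contractedEdge w v) (sym (trans (adj-sym G w v) v~w)))

    A-irrefl : ∀ z → A z z ≡ false
    A-irrefl (inj₁ x) = adj-irrefl F x
    A-irrefl (inj₂ v) = cong (_∧ contractedEdge v v) (adj-irrefl G v)

    nbrParityS-witness : ∀ {x v} → nbrParityS x v ≡ true → ∃ λ y → adj F x y ≡ true × (S ∩ fib v) y ≡ true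
    nbrParityS-witness {x} {v} e = let y , h = sum-true⇒∃ (λ y → adj F x y ∧ (S ∩ fib v) y) e in
      y , ∧-conicalˡ (adj F x y) _ h , ∧-conicalʳ (adj F x y) _ h

    nbrParityS-adj : ∀ {x v} → nbrParityS x v ≡ true → adj G (φ x) v ≡ true
    nbrParityS-adj {x} {v} e = let y , x~y , yv = nbrParityS-witness e in
      subst (λ t → adj G (φ x) t ≡ true) (==⇒≡ (∧-conicalʳ _ _ yv)) (proj₁ odm x y x~y)

    nbrParityS-vertex : ∀ {x v} → nbrParityS x v ≡ true → T (inj₂ v) ≡ true
    nbrParityS-vertex {x} {v} e
      rewrite anyFin-intro (S ∩ fib v) _ (proj₂ (proj₂ (nbrParityS-witness e)))
            | anyFin-intro (adj G v) (φ x) (trans (adj-sym G v (φ x)) (nbrParityS-adj e)) = refl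

    contractedNbrParity : ∀ {v w} → adj G v w ≡ true → edgeParityS w v xor (T (inj₂ w) ∧ contractedEdge v w) ≡ not (p v)
    contractedNbrParity {v} {w} v~w with img w in imgw
    ... | true rewrite anyFin-intro (adj G w) v (trans (adj-sym G w v) v~w) = xor-not-xor (edgeParityS w v) (p v)
    ... | false = begin
      edgeParityS w v xor false
        ≡⟨ xor-identityʳ _ ⟩
      edgeParityS w v
        ≡⟨ xor≡true⇒≡not (trans (sym (p-split w~v)) (p-offImage imgw)) ⟩
      not (edgeParity (C ∩ fib w) (C ∩ fib v))
        ≡⟨ cong not (edgeParity-sym _ _) ⟩
      not (edgeParity (C ∩ fib v) (C ∩ fib w))
        ≡⟨ cong not (trans (cong (edgeParity (C ∩ fib v) (C ∩ fib w) xor_) (edgeParity-offImage (C ∩ fib v) imgw)) (xor-identityʳ _)) ⟨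
      not (edgeParity (C ∩ fib v) (C ∩ fib w) xor edgeParityS v w)
        ≡⟨ cong not (p-split v~w) ⟨
      not (p v)
        ∎
      where
      w~v : adj G w v ≡ true
      w~v = trans (adj-sym G w v) v~w

    contraction-nbr : ∀ z → T z ≡ true → ∀ w → adj G (ψ z) w ≡ true → sum⊎ (λ z′ → T z′ ∧ (A z z′ ∧ (ψ z′ == w))) ≡ o z
    contraction-nbr (inj₁ x) Cx w x~w = begin
      sum (λ y → C y ∧ (adj F x y ∧ fib w y)) xor sum (λ u → T (inj₂ u) ∧ (nbrParityS x u ∧ (u == w)))
        ≡⟨ cong₂ _xor_ (sum-cong-≗ (λ y → ∧-x∙yz≈y∙xz (C y) (adj F x y) (fib w y))) (sum-pick-∧== (T ∘ inj₂) (nbrParityS x) w) ⟩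
      nbrParity (C ∩ fib w) x xor (T (inj₂ w) ∧ nbrParityS x w)
        ≡⟨ cong (nbrParity (C ∩ fib w) x xor_) (vertex∧nbrParityS w) ⟩
      nbrParity (C ∩ fib w) x xor nbrParityS x w
        ≡⟨ nbrParity-split (not ∘ J) (fib w) Cx ⟨
      nbrParity (fib w) x
        ≡⟨ nbrParity≡odd x refl w x~w ⟩
      odd x
        ∎
      where
      vertex∧nbrParityS : ∀ w → T (inj₂ w) ∧ nbrParityS x w ≡ nbrParityS x w
      vertex∧nbrParityS w with nbrParityS x w in e
      ... | false = ∧-zeroʳ _
      ... | true  = trans (cong (_∧ true) (nbrParityS-vertex e)) refl
    contraction-nbr (inj₂ v) _ w v~w = begin
      sum (λ x → C x ∧ (nbrParityS x v ∧ fib w x))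
        xor sum (λ u → T (inj₂ u) ∧ ((adj G v u ∧ contractedEdge v u) ∧ (u == w)))
        ≡⟨ cong₂ _xor_ (sum-cong-≗ (λ x → ∧-x∙yz≈xz∙y (C x) (nbrParityS x v) (fib w x)))
                       (sum-pick-∧== (T ∘ inj₂) (λ u → adj G v u ∧ contractedEdge v u) w) ⟩
      edgeParityS w v xor (T (inj₂ w) ∧ (adj G v w ∧ contractedEdge v w))
        ≡⟨ cong (λ e → edgeParityS w v xor (T (inj₂ w) ∧ (e ∧ contractedEdge v w))) v~w ⟩
      edgeParityS w v xor (T (inj₂ w) ∧ contractedEdge v w)
        ≡⟨ contractedNbrParity v~w ⟩
      not (p v)
        ∎

    contractionParities : OddParities sum⊎ T A G ψ o
    contractionParities = record { hom = hom ; nbr = contraction-nbr ; isolated = isolated ; fibre = fibre }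
      where
      hom : ∀ z z′ → T z ≡ true → T z′ ≡ true → A z z′ ≡ true → adj G (ψ z) (ψ z′) ≡ true
      hom (inj₁ x) (inj₁ y) _ _ x~y = proj₁ odm x y x~y
      hom (inj₁ x) (inj₂ v) _ _ e   = nbrParityS-adj e
      hom (inj₂ v) (inj₁ x) _ _ e   = trans (adj-sym G v (φ x)) (nbrParityS-adj e)
      hom (inj₂ v) (inj₂ w) _ _ e   = ∧-conicalˡ _ _ e
      isolated : ∀ z → T z ≡ true → anyFin (adj G (ψ z)) ≡ false → o z ≡ true
      isolated (inj₁ x) _  none = isolated-odd x refl none
      isolated (inj₂ v) Tv none =
        ∧-conicalʳ (img v) (not (p v)) (trans (cong (λ h → img v ∧ (h ∨ not (p v))) (sym none)) Tv)
      fibre : ∀ v → sum⊎ (λ z → T z ∧ ((ψ z == v) ∧ o z)) ≡ true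
      fibre v = trans (cong (p v xor_) (trans (sum-cong-≗ (λ u → ∧-x∙yz≈xz∙y (T (inj₂ u)) (u == v) (not (p u))))
                                               (sum-pick-== (λ u → T (inj₂ u) ∧ not (p u)) v)))
                       fibreParity
        where
        fibreParity : p v xor (T (inj₂ v) ∧ not (p v)) ≡ true
        fibreParity with img v in imgv
        ... | false rewrite p-offImage imgv = refl
        ... | true  = xor-∨-not (anyFin (adj G v)) (p v)

    branch : Fin a ⊎ Fin b → Fin a → Bool
    branch (inj₁ x) y = x == y
    branch (inj₂ v) y = (S ∩ fib v) y

    clique : ∀ {y y′} → S y ≡ true → S y′ ≡ true → y ≢ y′ → addClique F S y y′ ≡ true
    clique {y} {y′} Sy Sy′ y≢y′ with y ≟ y′
    ... | yes y≡y′ = ⊥-elim (y≢y′ y≡y′)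
    ... | no _ rewrite Sy | Sy′ = refl

    adj⇒clique : ∀ {y y′} → adj F y y′ ≡ true → addClique F S y y′ ≡ true
    adj⇒clique {y} {y′} y~y′ = trans (cong (_ ∨_) y~y′) (∨-zeroʳ _)

    C∩S-empty : ∀ {y} → C y ≡ true → S y ≡ true → ⊥
    C∩S-empty {y} Cy Sy = contradiction (trans (sym Cy) (cong (λ s → not s ∧ not (J (labF y))) Sy)) λ ()

    contraction-edges : ∀ z z′ → T z ≡ true → T z′ ≡ true → A z z′ ≡ true →
            ∃ λ y → ∃ λ y′ → branch z y ≡ true × branch z′ y′ ≡ true × addClique F S y y′ ≡ true
    contraction-edges (inj₁ x) (inj₁ x′) _ _ x~x′ = x , x′ , ==-refl x , ==-refl x′ , adj⇒clique x~x′
    contraction-edges (inj₁ x) (inj₂ v)  _ _ e    = let y , x~y , yv = nbrParityS-witness e in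
      x , y , ==-refl x , yv , adj⇒clique x~y
    contraction-edges (inj₂ v) (inj₁ x)  _ _ e    = let y , x~y , yv = nbrParityS-witness e in
      y , x , yv , ==-refl x , adj⇒clique (trans (adj-sym F y x) x~y)
    contraction-edges (inj₂ v) (inj₂ w)  Tv Tw e  = y , y′ , yv , y′w , clique (∧-conicalˡ _ _ yv) (∧-conicalˡ _ _ y′w) y≢y′
      where
      y  = proj₁ (anyFin-elim (S ∩ fib v) (∧-conicalˡ _ _ Tv))
      yv = proj₂ (anyFin-elim (S ∩ fib v) (∧-conicalˡ _ _ Tv))
      y′  = proj₁ (anyFin-elim (S ∩ fib w) (∧-conicalˡ _ _ Tw))
      y′w = proj₂ (anyFin-elim (S ∩ fib w) (∧-conicalˡ _ _ Tw))
      y≢y′ : y ≢ y′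
      y≢y′ y≡y′ = contradiction (trans (sym (∧-conicalˡ _ _ e)) (subst (λ t → adj G v t ≡ false) v≡w (adj-irrefl G v))) λ ()
        where
        v≡w : v ≡ w
        v≡w = trans (sym (==⇒≡ (∧-conicalʳ (S y) _ yv)))
                    (trans (cong φ y≡y′) (==⇒≡ (∧-conicalʳ (S y′) _ y′w)))

    contractionModel : MinorModelOn T A (addClique F S) (λ x → S x ∨ C x)
    contractionModel = record
      { branch = branch ; inside = inside ; nonempty = nonempty ; disjoint = disjoint
      ; connected = connected ; edges = contraction-edges }
      where
      inside : ∀ z y → T z ≡ true → branch z y ≡ true → S y ∨ C y ≡ true
      inside (inj₁ x) y Cx xy = subst (λ t → S t ∨ C t ≡ true) (==⇒≡ xy) (trans (cong (S x ∨_) Cx) (∨-zeroʳ (S x)))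
      inside (inj₂ v) y _  yv = cong (_∨ C y) (∧-conicalˡ _ _ yv)
      nonempty : ∀ z → T z ≡ true → ∃ λ y → branch z y ≡ true
      nonempty (inj₁ x) _  = x , ==-refl x
      nonempty (inj₂ v) Tv = anyFin-elim (S ∩ fib v) (∧-conicalˡ _ _ Tv)
      disjoint : ∀ z z′ y → T z ≡ true → T z′ ≡ true → branch z y ≡ true → branch z′ y ≡ true → z ≡ z′
      disjoint (inj₁ x) (inj₁ x′) y _  _  xy  x′y = cong inj₁ (trans (==⇒≡ xy) (sym (==⇒≡ x′y)))
      disjoint (inj₁ x) (inj₂ v)  y Cx _  xy  yv  =
        ⊥-elim (C∩S-empty (subst (λ t → C t ≡ true) (==⇒≡ xy) Cx) (∧-conicalˡ _ _ yv))
      disjoint (inj₂ v) (inj₁ x)  y _  Cx yv  xy  =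
        ⊥-elim (C∩S-empty (subst (λ t → C t ≡ true) (==⇒≡ xy) Cx) (∧-conicalˡ _ _ yv))
      disjoint (inj₂ v) (inj₂ v′) y _  _  yv  yv′ =
        cong inj₂ (trans (sym (==⇒≡ (∧-conicalʳ (S y) _ yv))) (==⇒≡ (∧-conicalʳ (S y) _ yv′)))
      connected : ∀ z y y′ → T z ≡ true → branch z y ≡ true → branch z y′ ≡ true →
                  Reach (addClique F S) (branch z) y y′
      connected (inj₁ x) y y′ _ xy xy′ =
        subst₂ (Reach (addClique F S) (x ==_)) (==⇒≡ xy) (==⇒≡ xy′) (here (==-refl x))
      connected (inj₂ v) y y′ _ yv y′v with y ≟ y′
      ... | yes refl  = here yv
      ... | no  y≢y′ = step yv (clique (∧-conicalˡ _ _ yv) (∧-conicalˡ _ _ y′v) y≢y′) (here y′v)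

lemma4p1 : ∀ {a b : ℕ} (F : Graph a) (G : Graph b) (φ : Fin a → Fin b)
    → IsOddomorphism F G φ
    → (S : Fin a → Bool)
    → (n : ℕ) (labF : Fin a → Fin n) → IsComponentLabelling F (λ x → not (S x)) n labF
    → (m : ℕ) (labG : Fin b → Fin m) → IsComponentLabelling G (λ v → not (image φ S v)) m labG
    → n > m
    → ∃ λ (I : Fin n → Bool) → (∃ λ i → I i ≡ false)
      × ∃ λ (k : ℕ) → ∃ λ (F' : Graph k)
        → MinorModel (addClique F S) (λ x → S x ∨ (not (S x) ∧ I (labF x))) F'
        × ∃ λ (ψ : Fin k → Fin b) → IsOddomorphism F' G ψ
lemma4p1 F G φ odm S n labF compF m labG compG n>m
  with linearlyDependent (ComponentParities.parityVector F G φ odm S n labF compF m labG compG) n>m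
... | J , (i , Ji) , J-vanish =
  not ∘ J , (i , cong not Ji) , size , graph , minorModel contractionModel , ψ ∘ index , oddomorphism contractionParities
  where
  open ComponentParities F G φ odm S n labF compF m labG compG
  open Contraction J J-vanish
  open Enumeration (enumerate⊎ T) using (size; index)
  open Induced (enumerate⊎ T) A A-sym A-irrefl
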